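{- If $G$ is a bipartite simple graph of order $n\ge2$, then $S[G,t]$ is bipartite for every positive integer $t$.
   Context: Let $G$ be a simple graph with vertex set $V=\{1,\dots,n\}$, $n\ge 2$. For $t\ge 1$, the generalized Sierpiński graph $S(G,t)$ has vertex set $V^t$ (words $u_1u_2\cdots u_t$ over $V$), and two words ${\bf u}=u_1\cdots u_t$, ${\bf v}=v_1\cdots v_t$ are adjacent iff there is $i\in\{1,\dots,t\}$ with $u_j=v_j$ for $j<i$, $u_i\neq v_i$ and $u_iv_i\in E(G)$, and $u_j=v_i$, $v_j=u_i$ for all $j>i$. An edge of this kind with $i<t$ is called a linking edge. The generalized Sierpiński gasket $S[G,t]$ is the graph obtained from $S(G,t)$ by contracting all linking edges (so $S[G,1]=G$). -}

module Defs where

open import Level using (Level; _⊔_) renaming (suc to lsuc; zero to lzero)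
open import Data.Nat using (ℕ; zero; suc; _+_)
open import Data.Fin using (Fin)
open import Data.Vec using (Vec; []; _∷_; _++_; replicate)
open import Data.Bool using (Bool)
open import Data.Product using (Σ; ∃; _×_)
open import Relation.Nullary using (¬_)
open import Relation.Binary.PropositionalEquality using (_≡_; _≢_)
open import Relation.Binary.Construct.Closure.Symmetric using (SymClosure)
open import Relation.Binary.Construct.Closure.ReflexiveTransitive using (Star)

record SimpleGraph (n : ℕ) : Set₁ where
  field
    Adj    : Fin n → Fin n → Set
    sym    : ∀ {a b} → Adj a b → Adj b a
    irrefl : ∀ {a} → ¬ Adj a a

Bipartite : ∀ {n} → SimpleGraph n → Set
Bipartite G = Σ (Fin _ → Bool) λ c → ∀ a b → SimpleGraph.Adj G a b → c a ≢ c b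

-- Edges of the generalized Sierpiński graph S(G,t), on words Vec (Fin n) t.
-- The edge  w a b^m  ~  w b a^m  (w a prefix of length k, a b ∈ E(G)) is an
-- edge at position i = k+1 of a word of length t = k + 1 + m.
-- It is a linking edge iff i < t, i.e. m ≥ 1.
data LinkingEdge {n : ℕ} (G : SimpleGraph n) : {t : ℕ} → Vec (Fin n) t → Vec (Fin n) t → Set where
  link : ∀ {k m} (w : Vec (Fin n) k) (a b : Fin n) → SimpleGraph.Adj G a b →
         LinkingEdge G (w ++ (a ∷ replicate (suc m) b)) (w ++ (b ∷ replicate (suc m) a))

-- Non-linking edges of S(G,t) (position i = t): words differing only in the last letter.
data LastEdge {n : ℕ} (G : SimpleGraph n) : {t : ℕ} → Vec (Fin n) t → Vec (Fin n) t → Set where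
  last : ∀ {k} (w : Vec (Fin n) k) (a b : Fin n) → SimpleGraph.Adj G a b →
         LastEdge G (w ++ (a ∷ [])) (w ++ (b ∷ []))

-- Contracting all linking edges: two words represent the same vertex of
-- S[G,t] iff they are joined by a path of linking edges (equivalence closure).
SameGasketVertex : ∀ {n} (G : SimpleGraph n) {t : ℕ} → Vec (Fin n) t → Vec (Fin n) t → Set
SameGasketVertex G = Star (SymClosure (LinkingEdge G))

-- Bipartiteness of the gasket S[G,t] = S(G,t) / (linking edges).
-- A vertex colouring of S[G,t] is a colouring of words constant on contracted
-- classes; edges of S[G,t] are the images of the non-linking edges of S(G,t)
-- joining two distinct classes (loops arising from contraction are discarded,
-- as in simple-graph contraction).
GasketBipartite : ∀ {n} (G : SimpleGraph n) (t : ℕ) → Set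
GasketBipartite {n} G t =
  Σ (Vec (Fin n) t → Bool) λ f →
    (∀ u v → SameGasketVertex G u v → f u ≡ f v) ×
    (∀ u v → LastEdge G u v → ¬ SameGasketVertex G u v → f u ≢ f v)

{-# OPTIONS --safe #-}
-- Colour a word by the parity of the G-colours of its last two letters (a
-- one-letter word by the colour of that letter).  A linking edge
-- w a b^(m+1) ~ w b a^(m+1) ends in ab / ba or in bb / aa, whose parities
-- agree, so the colouring is constant on contracted classes.  A non-linking
-- edge w a ~ w b only replaces the last letter by a G-neighbour, which has
-- the other colour, so it flips the parity.
module Submission where

open import Defs
open import Data.Nat using (ℕ; _≤_; zero; suc)
open import Data.Fin using (Fin)
open import Data.Vec using (Vec; []; _∷_; _++_; replicate)
open import Data.Bool using (Bool; true; false; _xor_)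
open import Data.Bool.Properties using (xor-same; xor-comm; not-injective)
open import Data.Product using (_,_)
open import Relation.Binary.PropositionalEquality
  using (_≡_; _≢_; refl; sym; trans; isEquivalence; module ≡-Reasoning)
open import Relation.Binary.Construct.Closure.Equivalence using (gfold)

xor-cancelˡ : ∀ p {x y} → p xor x ≡ p xor y → x ≡ y
xor-cancelˡ false eq = eq
xor-cancelˡ true  eq = not-injective eq

module _ {A : Set} (c : A → Bool) where

  lastColour : ∀ {k} → Vec A k → Bool
  lastColour []          = false
  lastColour (x ∷ [])    = c x
  lastColour (_ ∷ y ∷ w) = lastColour (y ∷ w)

  gasketColour : ∀ {t} → Vec A t → Bool
  gasketColour []              = false
  gasketColour (x ∷ [])        = c x
  gasketColour (x ∷ y ∷ [])    = c x xor c y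
  gasketColour (_ ∷ y ∷ z ∷ w) = gasketColour (y ∷ z ∷ w)

  gasketColour-++-∷-∷ : ∀ {k m} (w : Vec A k) x y (r : Vec A m) →
                        gasketColour (w ++ x ∷ y ∷ r) ≡ gasketColour (x ∷ y ∷ r)
  gasketColour-++-∷-∷ []              x y r = refl
  gasketColour-++-∷-∷ (_ ∷ [])        x y r = refl
  gasketColour-++-∷-∷ (_ ∷ _ ∷ [])    x y r = refl
  gasketColour-++-∷-∷ (_ ∷ u ∷ v ∷ w) x y r = gasketColour-++-∷-∷ (u ∷ v ∷ w) x y r

  gasketColour-++-∷-[] : ∀ {k} (w : Vec A k) x →
                         gasketColour (w ++ x ∷ []) ≡ lastColour w xor c x
  gasketColour-++-∷-[] []              x = refl
  gasketColour-++-∷-[] (_ ∷ [])        x = refl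
  gasketColour-++-∷-[] (_ ∷ _ ∷ [])    x = refl
  gasketColour-++-∷-[] (_ ∷ u ∷ v ∷ w) x = gasketColour-++-∷-[] (u ∷ v ∷ w) x

  gasketColour-constant : ∀ m b → gasketColour (b ∷ b ∷ replicate m b) ≡ false
  gasketColour-constant zero    b = xor-same (c b)
  gasketColour-constant (suc m) b = gasketColour-constant m b

  gasketColour-swap : ∀ m a b →
    gasketColour (a ∷ b ∷ replicate m b) ≡ gasketColour (b ∷ a ∷ replicate m a)
  gasketColour-swap zero    a b = xor-comm (c a) (c b)
  gasketColour-swap (suc m) a b =
    trans (gasketColour-constant m b) (sym (gasketColour-constant m a))

module _ {n : ℕ} {G : SimpleGraph n} where

  gasketColour-linkingEdge : ∀ (c : Fin n → Bool) {t} {u v : Vec (Fin n) t} →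
                             LinkingEdge G u v → gasketColour c u ≡ gasketColour c v
  gasketColour-linkingEdge c (link {m = m} w a b _) = begin
    gasketColour c (w ++ a ∷ b ∷ replicate m b) ≡⟨ gasketColour-++-∷-∷ c w a b _ ⟩
    gasketColour c (a ∷ b ∷ replicate m b)      ≡⟨ gasketColour-swap c m a b ⟩
    gasketColour c (b ∷ a ∷ replicate m a)      ≡⟨ gasketColour-++-∷-∷ c w b a _ ⟨
    gasketColour c (w ++ b ∷ a ∷ replicate m a) ∎
    where open ≡-Reasoning

  gasketColour-sameGasketVertex : ∀ (c : Fin n → Bool) {t} {u v : Vec (Fin n) t} →
                                  SameGasketVertex G u v → gasketColour c u ≡ gasketColour c v
  gasketColour-sameGasketVertex c =
    gfold isEquivalence (gasketColour c) (gasketColour-linkingEdge c)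

  gasketColour-lastEdge : ∀ (c : Fin n → Bool) → (∀ a b → SimpleGraph.Adj G a b → c a ≢ c b) →
                          ∀ {t} {u v : Vec (Fin n) t} →
                          LastEdge G u v → gasketColour c u ≢ gasketColour c v
  gasketColour-lastEdge c proper (last w a b adj) eq =
    proper a b adj (xor-cancelˡ (lastColour c w) (begin
      lastColour c w xor c a       ≡⟨ gasketColour-++-∷-[] c w a ⟨
      gasketColour c (w ++ a ∷ []) ≡⟨ eq ⟩
      gasketColour c (w ++ b ∷ []) ≡⟨ gasketColour-++-∷-[] c w b ⟩
      lastColour c w xor c b       ∎))
    where open ≡-Reasoning

mainTheorem6 : (n : ℕ) → 2 ≤ n → (G : SimpleGraph n) → Bipartite G →
    (t : ℕ) → 1 ≤ t → GasketBipartite G t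
mainTheorem6 n _ G (c , proper) t _ =
  gasketColour c ,
  (λ _ _ → gasketColour-sameGasketVertex c) ,
  (λ _ _ e _ → gasketColour-lastEdge c proper e)
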